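{- Let $\mathfrak{X}=\langle X,\tau^0,\tau^1\rangle$ be the ultrabouquet described in the context. Then the topological space $\langle X,\tau^0\rangle$ is scattered; that is, $\mathfrak{X}$ is a $\mathbf{CL}$-space.
   Context: For a topology $\tau$ on $X$, $d_\tau(Y)=\{x: \text{every } U\in\tau \text{ containing } x \text{ meets } Y\setminus\{x\}\}$; $\langle X,\tau\rangle$ is scattered if $Y\setminus d_\tau(Y)\ne\varnothing$ for every nonempty $Y\subseteq X$. A bitopological space is $\langle X,\tau^0,\tau^1\rangle$ with $X\ne\varnothing$ and $\tau^0,\tau^1$ topologies on $X$. A $\mathbf{CL}$-space is a bitopological space validating all theorems of the conservativity logic $\mathbf{CL}$ (under the semantics $\Box\mapsto cd_{\tau^0}$, $\Diamond\mapsto d_{\tau^0}$, $\rhd\mapsto e_{\tau^0,\tau^1}$, where $cd_\tau(Y)=X\setminus d_\tau(X\setminus Y)$ and $e_{\tau^0,\tau^1}(Y,Z)=\{x:\forall U\in\tau^1[x\in d_{\tau^0}(Y\cap U)\Rightarrow x\in d_{\tau^0}(Z\cap U)]\}$); these are exactly the bitopological spaces with $\langle X,\tau^0\rangle$ scattered. Ultrabouquet: $\{\langle X_n,\tau^0_n,\tau^1_n\rangle\}_{n\in\mathbb{N}}$ are bitopological spaces with each $\langle X_n,\tau^0_n\rangle$ scattered and the $X_n$ pairwise disjoint; $x_n\in X_n$; $Y_n\subseteq X_n$ with $x_n\in Y_n\in\tau^0_n$ and $Y_n\setminus\{x_n\}\in\tau^0_n$; $\mathcal{U}$ a non-principal ultrafilter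 on $\mathbb{N}$; $x_\ast\notin\bigcup_nX_n$ a new point. $X=\bigcup_n(X_n\setminus\{x_n\})\cup\{x_\ast\}$. For $V\subseteq X$, $V\restriction X_n=V\cap X_n$ if $x_\ast\notin V$, and $((V\setminus\{x_\ast\})\cup\{x_n\})\cap X_n$ if $x_\ast\in V$; $V\restriction Y_n$ likewise. $U\in\tau^0$ iff (i) $U\cap(Y_n\setminus\{x_n\})\in\tau^0_n$ for all $n$ and (ii) if $x_\ast\in U$ then $\{n:U\restriction Y_n\in\tau^0_n\}\in\mathcal{U}$; $U\in\tau^1$ iff $U\restriction X_n\in\tau^1_n$ for all $n$. -}

module Defs where

open import Level using (Level; 0ℓ) renaming (suc to lsuc)
open import Data.Nat using (ℕ)
open import Data.Maybe using (Maybe; just; nothing)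
open import Data.Product using (Σ; ∃; _×_; _,_)
open import Data.Sum using (_⊎_)
open import Data.Unit using (⊤)
open import Data.Empty using (⊥)
open import Relation.Nullary using (¬_)
open import Relation.Binary.PropositionalEquality using (_≡_; _≢_)

Subset : Set → Set₁
Subset A = A → Set

_⊆_ : {A : Set} → Subset A → Subset A → Set
P ⊆ Q = ∀ x → P x → Q x

full : {A : Set} → Subset A
full _ = ⊤

record IsTopologyOn {A : Set} (C : Subset A) (Open : Subset A → Set) : Set₁ where
  field
    open⊆C      : ∀ U → Open U → U ⊆ C
    -- open sets are determined by their elements
    open-ext    : ∀ U V → U ⊆ V → V ⊆ U → Open U → Open V
    open-∅      : Open (λ _ → ⊥)
    open-C      : Open C
    open-∩      : ∀ U V → Open U → Open V → Open (λ x → U x × V x)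
    open-⋃      : (I : Set) (U : I → Subset A) → (∀ i → Open (U i)) →
                  Open (λ x → Σ I (λ i → U i x))

IsTopology : {A : Set} → (Subset A → Set) → Set₁
IsTopology = IsTopologyOn full

derived : {A : Set} (Open : Subset A → Set) → Subset A → A → Set₁
derived Open Y x = ∀ U → Open U → U x → ∃ λ y → U y × Y y × y ≢ x

ScatteredOn : {A : Set} (C : Subset A) (Open : Subset A → Set) → Set₁
ScatteredOn C Open =
  ∀ (Y : Subset _) → Y ⊆ C → (∃ λ y → Y y) → ∃ λ y → Y y × ¬ derived Open Y y

Scattered : {A : Set} (Open : Subset A → Set) → Set₁
Scattered = ScatteredOn full

record IsUltrafilter (𝒰 : Subset ℕ → Set) : Set₁ where
  field
    has-ℕ   : 𝒰 (λ _ → ⊤)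
    no-∅    : ¬ 𝒰 (λ _ → ⊥)
    up      : ∀ A B → A ⊆ B → 𝒰 A → 𝒰 B
    ∩-clos  : ∀ A B → 𝒰 A → 𝒰 B → 𝒰 (λ n → A n × B n)
    ultra   : ∀ A → 𝒰 A ⊎ 𝒰 (λ n → ¬ A n)

NonPrincipal : (Subset ℕ → Set) → Set
NonPrincipal 𝒰 = ∀ n → ¬ 𝒰 (λ m → m ≡ n)

-- The pairwise disjoint spaces X_n are the fibres of the disjoint union
-- Σ ℕ Xs; the ambient point type is Maybe (Σ ℕ Xs), where `nothing` is the
-- new point x∗ and `just (n , x)` is x ∈ X_n.

module Ultrabouquet (Xs : ℕ → Set) (xₙ : (n : ℕ) → Xs n)
                    (Ys : (n : ℕ) → Subset (Xs n))
                    (τ⁰ : (n : ℕ) → Subset (Xs n) → Set)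
                    (𝒰 : Subset ℕ → Set) where

  Pt : Set
  Pt = Maybe (Σ ℕ Xs)

  UB-X : Subset Pt
  UB-X nothing        = ⊤
  UB-X (just (n , x)) = x ≢ xₙ n

  cut : Subset Pt → (n : ℕ) → Subset (Xs n)
  cut U n x = U (just (n , x)) × Ys n x × x ≢ xₙ n

  -- U ↾ Y_n in the case x∗ ∈ U :  ((U ∖ {x∗}) ∪ {x_n}) ∩ Y_n
  restrY : Subset Pt → (n : ℕ) → Subset (Xs n)
  restrY U n x = (U (just (n , x)) ⊎ x ≡ xₙ n) × Ys n x

  UB-τ⁰ : Subset Pt → Set
  UB-τ⁰ U = U ⊆ UB-X
          × (∀ n → τ⁰ n (cut U n))
          × (U nothing → 𝒰 (λ n → τ⁰ n (restrY U n)))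

-- A point of Y lying in some fibre X_n outside Y_n is isolated, since τ⁰ only
-- constrains the traces of open sets on the Y_n ∖ {x_n}. A point of Y in some
-- Y_n ∖ {x_n} may be chosen isolated within that fibre by scatteredness of X_n,
-- and its isolating neighbourhood, cut down to Y_n ∖ {x_n}, is open in the
-- ultrabouquet because it avoids x∗. If Y meets no fibre then Y = {x∗}, which
-- is isolated by the whole space.
module Submission where

open import Defs
open import Level using (0ℓ; lift; lower) renaming (suc to lsuc)
open import Axiom.ExcludedMiddle using (ExcludedMiddle)
open import Data.Nat using (ℕ; _≟_)
open import Data.Maybe using (just; nothing)
open import Data.Product using (Σ; ∃; _×_; _,_; proj₁; proj₂)
open import Data.Sum using (_⊎_; inj₁; inj₂)
open import Data.Unit using (tt)
open import Data.Empty using (⊥; ⊥-elim)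
open import Relation.Nullary using (¬_; Dec; yes; no)
open import Relation.Nullary.Decidable using (map′)
open import Relation.Binary.PropositionalEquality using (_≡_; _≢_; refl)

decide : ExcludedMiddle (lsuc 0ℓ) → (P : Set) → Dec P
decide lem P = map′ lower lift lem

open-empty : ∀ {A} {C : Subset A} {Open : Subset A → Set} → IsTopologyOn C Open →
             ∀ U → (∀ x → ¬ U x) → Open U
open-empty top U U-empty = open-ext (λ _ → ⊥) U (λ _ ()) U-empty open-∅
  where open IsTopologyOn top

Isolates : {A : Set} → (Subset A → Set) → Subset A → Subset A → A → Set
Isolates Open U Y y = Open U × U y × (∀ z → U z → Y z → z ≢ y → ⊥)

isolates⇒¬derived : ∀ {A} {Open : Subset A → Set} {U Y : Subset A} {y} →
                    Isolates Open U Y y → ¬ derived Open Y y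
isolates⇒¬derived (U-open , Uy , U∩Y⊆y) y∈dY with y∈dY _ U-open Uy
... | z , Uz , Yz , z≢y = U∩Y⊆y z Uz Yz z≢y

¬derived⇒isolates : ExcludedMiddle (lsuc 0ℓ) → ∀ {A} {Open : Subset A → Set} {Y : Subset A} {y} →
                    ¬ derived Open Y y → ∃ λ U → Isolates Open U Y y
¬derived⇒isolates lem {Open = Open} {Y} {y} y∉dY with lem {∃ λ U → Isolates Open U Y y}
... | yes isolated = isolated
... | no ¬isolated = ⊥-elim (y∉dY meets)
  where
  meets : derived Open Y y
  meets U U-open Uy with decide lem (∃ λ z → U z × Y z × z ≢ y)
  ... | yes witness = witness
  ... | no ¬witness =
    ⊥-elim (¬isolated (U , U-open , Uy , λ z Uz Yz z≢y → ¬witness (z , Uz , Yz , z≢y)))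

module UltrabouquetOpens (Xs : ℕ → Set) (xₙ : (n : ℕ) → Xs n) (Ys : (n : ℕ) → Subset (Xs n))
                         (τ⁰ : (n : ℕ) → Subset (Xs n) → Set) (𝒰 : Subset ℕ → Set)
                         (top : ∀ n → IsTopology (τ⁰ n)) where

  open Ultrabouquet Xs xₙ Ys τ⁰ 𝒰
  module τ⁰ n = IsTopologyOn (top n)

  embed : (n : ℕ) → Subset (Xs n) → Subset Pt
  embed n S p = Σ (Xs n) λ x → p ≡ just (n , x) × S x

  embed-open : ∀ n S → (∀ x → S x → x ≢ xₙ n) → τ⁰ n (λ x → S x × Ys n x) →
               UB-τ⁰ (embed n S)
  embed-open n S S∌xₙ S∩Yₙ-open =
    (λ { _ (x , refl , Sx) → S∌xₙ x Sx }) , cut-open , λ { (_ , () , _) }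
    where
    cut-open : ∀ m → τ⁰ m (cut (embed n S) m)
    cut-open m with m ≟ n
    ... | yes refl = τ⁰.open-ext n _ _
                       (λ x (Sx , Yx) → (x , refl , Sx) , Yx , S∌xₙ x Sx)
                       (λ { x ((.x , refl , Sx) , Yx , _) → Sx , Yx })
                       S∩Yₙ-open
    ... | no m≢n = open-empty (top m) _ λ { _ ((_ , refl , _) , _) → m≢n refl }

  X-open : ExcludedMiddle (lsuc 0ℓ) → IsUltrafilter 𝒰 →
           (∀ n → τ⁰ n (Ys n)) → (∀ n → τ⁰ n (λ x → Ys n x × x ≢ xₙ n)) → UB-τ⁰ UB-X
  X-open lem ultra Yₙ-open Yₙ∖xₙ-open =
    (λ _ Xp → Xp) , cut-open , λ _ → up full _ (λ n _ → restrY-open n) has-ℕ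
    where
    open IsUltrafilter ultra
    cut-open : ∀ n → τ⁰ n (cut UB-X n)
    cut-open n = τ⁰.open-ext n _ _ (λ x (Yx , x≢xₙ) → x≢xₙ , Yx , x≢xₙ)
                   (λ x (_ , Yx , x≢xₙ) → Yx , x≢xₙ) (Yₙ∖xₙ-open n)
    restrY-open : ∀ n → τ⁰ n (restrY UB-X n)
    restrY-open n = τ⁰.open-ext n _ _ (λ x Yx → X-or-xₙ x , Yx) (λ _ (_ , Yx) → Yx) (Yₙ-open n)
      where
      X-or-xₙ : ∀ x → UB-X (just (n , x)) ⊎ x ≡ xₙ n
      X-or-xₙ x with decide lem (x ≡ xₙ n)
      ... | yes x≡xₙ = inj₂ x≡xₙ
      ... | no x≢xₙ = inj₁ x≢xₙ

  singleton-isolates : (∀ n → Ys n (xₙ n)) → ∀ Y n x → ¬ Ys n x →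
                       Isolates UB-τ⁰ (embed n (_≡ x)) Y (just (n , x))
  singleton-isolates xₙ∈Yₙ Y n x x∉Yₙ =
    embed-open n _ (λ { _ refl refl → x∉Yₙ (xₙ∈Yₙ n) })
                   (open-empty (top n) _ λ { _ (refl , Yx) → x∉Yₙ Yx })
    , (x , refl , refl)
    , λ { _ (_ , refl , refl) _ z≢x → z≢x refl }

  fibre-isolates : (∀ n → τ⁰ n (λ x → Ys n x × x ≢ xₙ n)) → ∀ Y n V z →
                   Isolates (τ⁰ n) V (cut Y n) z → cut Y n z →
                   Isolates UB-τ⁰ (embed n (λ x → V x × Ys n x × x ≢ xₙ n)) Y (just (n , z))
  fibre-isolates Yₙ∖xₙ-open Y n V z (V-open , Vz , V∩Y⊆z) (_ , Yz , z≢xₙ) =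
    embed-open n _ (λ _ (_ , _ , x≢xₙ) → x≢xₙ)
      (τ⁰.open-ext n _ _ (λ _ (Vx , Yx , x≢xₙ) → (Vx , Yx , x≢xₙ) , Yx) (λ _ (V∩Yx , _) → V∩Yx)
        (τ⁰.open-∩ n V _ V-open (Yₙ∖xₙ-open n)))
    , (z , refl , Vz , Yz , z≢xₙ)
    , λ { _ (x , refl , Vx , Yx , x≢xₙ) Y[x] x≢z →
            V∩Y⊆z x Vx (Y[x] , Yx , x≢xₙ) λ { refl → x≢z refl } }

  x∗-isolates : UB-τ⁰ UB-X → ∀ Y → (∀ n x → ¬ Y (just (n , x))) → Isolates UB-τ⁰ UB-X Y nothing
  x∗-isolates X-is-open Y Y∩fibres-empty =
    X-is-open , tt , λ { nothing _ _ z≢x∗ → z≢x∗ refl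
                       ; (just (n , x)) _ Yx _ → Y∩fibres-empty n x Yx }

lemma4p10 : ExcludedMiddle (lsuc 0ℓ) →
    (Xs : ℕ → Set) (τ⁰ : (n : ℕ) → Subset (Xs n) → Set) →
    (∀ n → IsTopology (τ⁰ n)) →
    (∀ n → Scattered (τ⁰ n)) →
    (xₙ : (n : ℕ) → Xs n) →
    (Ys : (n : ℕ) → Subset (Xs n)) →
    (∀ n → Ys n (xₙ n)) →
    (∀ n → τ⁰ n (Ys n)) →
    (∀ n → τ⁰ n (λ x → Ys n x × x ≢ xₙ n)) →
    (𝒰 : Subset ℕ → Set) → IsUltrafilter 𝒰 → NonPrincipal 𝒰 →
    ScatteredOn (Ultrabouquet.UB-X Xs xₙ Ys τ⁰ 𝒰) (Ultrabouquet.UB-τ⁰ Xs xₙ Ys τ⁰ 𝒰)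
lemma4p10 lem Xs τ⁰ top scat xₙ Ys xₙ∈Yₙ Yₙ-open Yₙ∖xₙ-open 𝒰 ultra _ Y Y⊆X (y , Yy) =
  isolated-point (decide lem (∃ λ n → ∃ λ x → Y (just (n , x))))
  where
  open Ultrabouquet Xs xₙ Ys τ⁰ 𝒰
  open UltrabouquetOpens Xs xₙ Ys τ⁰ 𝒰 top

  isolated-point : Dec (∃ λ n → ∃ λ x → Y (just (n , x))) → ∃ λ y → Y y × ¬ derived UB-τ⁰ Y y
  isolated-point (yes (n , x , Yx)) with decide lem (Ys n x)
  ... | no x∉Yₙ = _ , Yx , isolates⇒¬derived (singleton-isolates xₙ∈Yₙ Y n x x∉Yₙ)
  ... | yes x∈Yₙ with scat n (cut Y n) (λ _ _ → tt) (x , Yx , x∈Yₙ , Y⊆X _ Yx)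
  ...   | z , Zz , z∉dZ =
    _ , proj₁ Zz
      , isolates⇒¬derived (fibre-isolates Yₙ∖xₙ-open Y n _ z (proj₂ (¬derived⇒isolates lem z∉dZ)) Zz)
  isolated-point (no Y∩fibres-empty) = x∗-in-Y y Yy
    where
    x∗-in-Y : ∀ p → Y p → ∃ λ y → Y y × ¬ derived UB-τ⁰ Y y
    x∗-in-Y (just (n , x)) Yx = ⊥-elim (Y∩fibres-empty (n , x , Yx))
    x∗-in-Y nothing Yx∗ =
      _ , Yx∗ , isolates⇒¬derived
                  (x∗-isolates (X-open lem ultra Yₙ-open Yₙ∖xₙ-open) Y λ n x Yx → Y∩fibres-empty (n , x , Yx))
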